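{- Let $\rho$ be a typing derivation of a program that is safe with respect to a variable typing environment $\Gamma$ and a safe operator typing environment $\Delta$. For any typing derivations $\rho_1\in\mathcal{D}(\rho)$ with root $\Gamma,\Delta\vdash c_1:(t^1,t^1_{in},t^1_{out})$ and $\rho_2\in\mathcal{D}(\rho_1)$ with root $\Gamma,\Delta\vdash c_2:(t^2,t^2_{in},t^2_{out})$, where $c_1,c_2$ are commands, we have $t^2\preceq t^1$.
   Context: Programs. Fix a set of variables and a set of operators, each operator $\mathtt{op}$ having an arity $ar(\mathtt{op})\ge0$ and a total function $[\![\mathtt{op}]\!]$ on words. With a single oracle symbol $\phi$: expressions $e::=x\mid \mathtt{op}(e_1,\dots,e_{ar(\mathtt{op})})\mid \phi(e_1\upharpoonright e_2)$; commands $c::=\mathtt{skip}\mid x:=e\mid c_1;c_2\mid \mathtt{if}(e)\{c_1\}\,\mathtt{else}\,\{c_0\}\mid \mathtt{while}(e)\{c\}$; programs $p_\phi::=c\ \mathtt{return}\ x$. Operators. For words, $v\unlhd w$ means $v$ is a contiguous subword of $w$. $\mathtt{op}$ is neutral if $ar(\mathtt{op})=0$, or $[\![\mathtt{op}]\!]$ takes values in $\{0,1\}$, or for all $\bar w$ there is $i$ with $[\![\mathtt{op}]\!](\bar w)\unlhd w_i$. $\mathtt{op}$ is positive if there is a constant $c$ with $|[\![\mathtt{op}]\!](\bar w)|\le\max_i|w_i|+c$ for all $\bar w$. Typing. Tiers are natural numbers $\mathbf 0,\mathbf 1,\dots$ with the usual order $\preceq$ (strict: $\prec$), $\vee=\max$,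 $\wedge=\min$. A variable typing environment $\Gamma$ maps variables to tiers; an operator typing environment $\Delta$ assigns to each operator $\mathtt{op}$ and tier $t$ a set $\Delta(\mathtt{op})(t)$ of types $t_1\to\dots\to t_{ar(\mathtt{op})}\to t'$. Judgments $\Gamma,\Delta\vdash b:(t,t_{in},t_{out})$ are derived by the rules (writing $\vdash$ for $\Gamma,\Delta\vdash$, all tiers arbitrary): (V) $\vdash x:(\Gamma(x),t_{in},t_{out})$; (OP) if $t_1\to\dots\to t_n\to t\in\Delta(\mathtt{op})(t_{in})$ and $\vdash e_i:(t_i,t_{in},t_{out})$ for all $i\le n=ar(\mathtt{op})$ then $\vdash\mathtt{op}(e_1,\dots,e_n):(t,t_{in},t_{out})$; (OR) if $\vdash e_1:(t,t_{in},t_{out})$, $\vdash e_2:(t_{out},t_{in},t_{out})$, $t\prec t_{in}$ and $t\preceq t_{out}$ then $\vdash\phi(e_1\upharpoonright e_2):(t,t_{in},t_{out})$; (SUB) for a command $c$, if $\vdash c:(t,t_{in},t_{out})$ then $\vdash c:(t+1,t_{in},t_{out})$; (SK) $\vdash\mathtt{skip}:(\mathbf0,t_{in},t_{out})$; (A) if $\vdash x:(t_1,t_{in},t_{out})$, $\vdash e:(t_2,t_{in},t_{out})$, $t_1\preceq t_2$ then $\vdash x:=e:(t_1,t_{in},t_{out})$; (S) if $\vdash c_1:\tau$ and $\vdash c_2:\tau$ then $\vdash c_1;c_2:\tau$; (C) if $\vdash e:\tau$, $\vdash c_1:\tau$, $\vdash c_0:\tau$ then $\vdash\mathtt{if}(e)\{c_1\}\mathtt{else}\{c_0\}:\tau$;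 (W) if $\vdash e:(t,t_{in},t_{out})$, $\vdash c:(t,t,t_{out})$ and $\mathbf1\preceq t\preceq t_{out}$ then $\vdash\mathtt{while}(e)\{c\}:(t,t_{in},t_{out})$; (W$_0$) if $\vdash e:(t,t_{in},t)$, $\vdash c:(t,t,t)$ and $\mathbf1\preceq t$ then $\vdash\mathtt{while}(e)\{c\}:(t,t_{in},\mathbf0)$. A typing derivation is a tree of instances of these rules; for a derivation $\rho$, $\mathcal{D}(\rho)$ is the set of its subtrees (including $\rho$ itself). A typing derivation of a program $c\ \mathtt{return}\ x$ is a typing derivation whose root is a judgment $\Gamma,\Delta\vdash c:(t,t_{in},t_{out})$. Safety. $\Delta$ is safe if for each operator $\mathtt{op}$ it types with $ar(\mathtt{op})>0$: $\mathtt{op}$ is neutral or positive, $[\![\mathtt{op}]\!]$ is polynomial-time computable, and for every tier $t_{in}$ and every $t_1\to\dots\to t_n\to t\in\Delta(\mathtt{op})(t_{in})$: $t\preceq\wedge_i t_i\preceq\vee_i t_i\preceq t_{in}$, and $t\prec t_{in}$ if $\mathtt{op}$ is positive but not neutral. A program $c\ \mathtt{return}\ x$ is safe with respect to $\Gamma,\Delta$ if $\Delta$ is safe and $\Gamma,\Delta\vdash c:(t,t_{in},t_{out})$ for some tiers. -}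

module Defs where

open import Data.Nat using (ℕ; zero; suc; _≤_; _<_; _+_; _⊔_)
open import Data.Fin using (Fin)
open import Data.List as L using (List; []; _∷_; _++_; length)
open import Data.Vec as V using (Vec; []; _∷_; lookup; toList)
open import Data.Product using (Σ; ∃; ∃-syntax; _×_; _,_)
open import Data.Sum using (_⊎_)
open import Relation.Nullary using (¬_)
open import Relation.Binary.PropositionalEquality using (_≡_)

record Lang : Set₁ where
  field
    Sym  : Set
    b0   : Sym
    b1   : Sym
    Var  : Set
    Op   : Set
    ar   : Op → ℕ

  Word : Set
  Word = List Sym

  field
    sem  : (o : Op) → Vec Word (ar o) → Word

module _ (L : Lang) where
  open Lang L

  _⊴_ : Word → Word → Set
  v ⊴ w = ∃[ u ] ∃[ u' ] (w ≡ u ++ (v ++ u'))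

  maxLen : ∀ {n} → Vec Word n → ℕ
  maxLen ws = L.foldr _⊔_ 0 (L.map length (toList ws))

  Neutral : Op → Set
  Neutral o =
      (ar o ≡ 0)
    ⊎ (∀ ws → (sem o ws ≡ b0 ∷ []) ⊎ (sem o ws ≡ b1 ∷ []))
    ⊎ (∀ ws → ∃[ i ] (sem o ws ⊴ lookup ws i))

  Positive : Op → Set
  Positive o = ∃[ c ] (∀ ws → length (sem o ws) ≤ maxLen ws + c)

  data Expr : Set where
    var : Var → Expr
    op  : (o : Op) → Vec Expr (ar o) → Expr
    orc : Expr → Expr → Expr                 -- φ(e₁ ↾ e₂)

  data Cmd : Set where
    skip  : Cmd
    _≔_   : Var → Expr → Cmd
    _︔_   : Cmd → Cmd → Cmd
    if_then_else_ : Expr → Cmd → Cmd → Cmd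
    while : Expr → Cmd → Cmd

  data Prog : Set where
    _return_ : Cmd → Var → Prog

  -- Typing environments (tiers are natural numbers)

  VarEnv : Set
  VarEnv = Var → ℕ

  -- Δ o t_in ts t  :  the type  ts₁ → … → tsₙ → t  belongs to Δ(o)(t_in)
  OpEnv : Set₁
  OpEnv = (o : Op) → ℕ → Vec ℕ (ar o) → ℕ → Set

  SafeOpEnv : (PolyTime : ∀ {n} → (Vec Word n → Word) → Set) → OpEnv → Set
  SafeOpEnv PolyTime Δ =
    ∀ (o : Op) → 0 < ar o → (∃[ tin ] ∃[ ts ] ∃[ t ] Δ o tin ts t) →
        (Neutral o ⊎ Positive o)
      × PolyTime (sem o)
      × (∀ tin ts t → Δ o tin ts t →
            (∀ i → t ≤ lookup ts i)
          × (∀ i → lookup ts i ≤ tin)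
          × (Positive o → ¬ Neutral o → t < tin))

  -- Typing derivations  Γ,Δ ⊢ b : (t , t_in , t_out)

  module Typing (Γ : VarEnv) (Δ : OpEnv) where

    data ExprD : Expr → ℕ → ℕ → ℕ → Set
    data ArgsD : ∀ {n} → Vec Expr n → Vec ℕ n → ℕ → ℕ → Set

    data ExprD where
      V  : ∀ {x tin tout} → ExprD (var x) (Γ x) tin tout
      OP : ∀ {o es ts t tin tout} → Δ o tin ts t → ArgsD es ts tin tout →
           ExprD (op o es) t tin tout
      OR : ∀ {e₁ e₂ t tin tout} → ExprD e₁ t tin tout → ExprD e₂ tout tin tout →
           t < tin → t ≤ tout → ExprD (orc e₁ e₂) t tin tout

    data ArgsD where
      []  : ∀ {tin tout} → ArgsD [] [] tin tout
      _∷_ : ∀ {n e t tin tout} {es : Vec Expr n} {ts} →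
            ExprD e t tin tout → ArgsD es ts tin tout → ArgsD (e ∷ es) (t ∷ ts) tin tout

    data CmdD : Cmd → ℕ → ℕ → ℕ → Set where
      SUB : ∀ {c t tin tout} → CmdD c t tin tout → CmdD c (suc t) tin tout
      SK  : ∀ {tin tout} → CmdD skip 0 tin tout
      A   : ∀ {x e t₁ t₂ tin tout} → ExprD (var x) t₁ tin tout → ExprD e t₂ tin tout →
            t₁ ≤ t₂ → CmdD (x ≔ e) t₁ tin tout
      S   : ∀ {c₁ c₂ t tin tout} → CmdD c₁ t tin tout → CmdD c₂ t tin tout →
            CmdD (c₁ ︔ c₂) t tin tout
      C   : ∀ {e c₁ c₀ t tin tout} → ExprD e t tin tout → CmdD c₁ t tin tout →
            CmdD c₀ t tin tout → CmdD (if e then c₁ else c₀) t tin tout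
      W   : ∀ {e c t tin tout} → ExprD e t tin tout → CmdD c t t tout →
            1 ≤ t → t ≤ tout → CmdD (while e c) t tin tout
      W₀  : ∀ {e c t tin} → ExprD e t tin t → CmdD c t t t →
            1 ≤ t → CmdD (while e c) t tin 0

    -- ρ' ∈ 𝒟(ρ), restricted to subtrees whose root is a command judgment
    -- (expression derivations have no command subtrees).
    data SubD : ∀ {c' t' i' o' c t i o} → CmdD c' t' i' o' → CmdD c t i o → Set where
      here  : ∀ {c t i o} {ρ : CmdD c t i o} → SubD ρ ρ
      inSUB : ∀ {c' t' i' o' c t i o} {ρ' : CmdD c' t' i' o'} {ρ : CmdD c t i o} →
              SubD ρ' ρ → SubD ρ' (SUB ρ)
      inS₁  : ∀ {c' t' i' o' c₁ c₂ t i o} {ρ' : CmdD c' t' i' o'}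
                {ρ₁ : CmdD c₁ t i o} {ρ₂ : CmdD c₂ t i o} → SubD ρ' ρ₁ → SubD ρ' (S ρ₁ ρ₂)
      inS₂  : ∀ {c' t' i' o' c₁ c₂ t i o} {ρ' : CmdD c' t' i' o'}
                {ρ₁ : CmdD c₁ t i o} {ρ₂ : CmdD c₂ t i o} → SubD ρ' ρ₂ → SubD ρ' (S ρ₁ ρ₂)
      inC₁  : ∀ {c' t' i' o' e c₁ c₀ t i o} {ρ' : CmdD c' t' i' o'} {δ : ExprD e t i o}
                {ρ₁ : CmdD c₁ t i o} {ρ₀ : CmdD c₀ t i o} → SubD ρ' ρ₁ → SubD ρ' (C δ ρ₁ ρ₀)
      inC₀  : ∀ {c' t' i' o' e c₁ c₀ t i o} {ρ' : CmdD c' t' i' o'} {δ : ExprD e t i o}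
                {ρ₁ : CmdD c₁ t i o} {ρ₀ : CmdD c₀ t i o} → SubD ρ' ρ₀ → SubD ρ' (C δ ρ₁ ρ₀)
      inW   : ∀ {c' t' i' o' e c t i o} {ρ' : CmdD c' t' i' o'} {δ : ExprD e t i o}
                {ρ : CmdD c t t o} {p : 1 ≤ t} {q : t ≤ o} → SubD ρ' ρ → SubD ρ' (W δ ρ p q)
      inW₀  : ∀ {c' t' i' o' e c t i} {ρ' : CmdD c' t' i' o'} {δ : ExprD e t i t}
                {ρ : CmdD c t t t} {p : 1 ≤ t} → SubD ρ' ρ → SubD ρ' (W₀ δ ρ p)

module Submission where

open import Defs
open import Data.Nat using (ℕ; _≤_)
open import Data.Vec using (Vec)
open import Data.Nat.Properties using (≤-refl; m≤n⇒m≤1+n)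

-- Every typing rule for commands gives its premises on commands the same tier
-- as its conclusion, except SUB, which raises it by one; so tiers can only
-- decrease along a path from the root of a derivation to a subderivation.

module _ (L : Lang) (Γ : VarEnv L) (Δ : OpEnv L) where
  open Typing L Γ Δ

  SubD⇒tier-≤ : ∀ {c' t' i' o' c t i o} {ρ' : CmdD c' t' i' o'} {ρ : CmdD c t i o} →
                SubD ρ' ρ → t' ≤ t
  SubD⇒tier-≤ here      = ≤-refl
  SubD⇒tier-≤ (inSUB s) = m≤n⇒m≤1+n (SubD⇒tier-≤ s)
  SubD⇒tier-≤ (inS₁ s)  = SubD⇒tier-≤ s
  SubD⇒tier-≤ (inS₂ s)  = SubD⇒tier-≤ s
  SubD⇒tier-≤ (inC₁ s)  = SubD⇒tier-≤ s
  SubD⇒tier-≤ (inC₀ s)  = SubD⇒tier-≤ s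
  SubD⇒tier-≤ (inW s)   = SubD⇒tier-≤ s
  SubD⇒tier-≤ (inW₀ s)  = SubD⇒tier-≤ s

lemma6p3 : (L : Lang) (PolyTime : ∀ {n} → (Vec (Lang.Word L) n → Lang.Word L) → Set)
    (Γ : VarEnv L) (Δ : OpEnv L) → SafeOpEnv L PolyTime Δ →
    let open Typing L Γ Δ in
    ∀ {c : Cmd L} {t tin tout} (ρ : CmdD c t tin tout) →
    ∀ {c₁ t¹ t¹in t¹out} (ρ₁ : CmdD c₁ t¹ t¹in t¹out) → SubD ρ₁ ρ →
    ∀ {c₂ t² t²in t²out} (ρ₂ : CmdD c₂ t² t²in t²out) → SubD ρ₂ ρ₁ →
    t² ≤ t¹
lemma6p3 L _ Γ Δ _ _ _ _ _ ρ₂⊑ρ₁ = SubD⇒tier-≤ L Γ Δ ρ₂⊑ρ₁
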